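{- Let $q\geq 3$ be an integer, $B\in(0,1)$, and set $\chi=\frac{1+B}{B+q-1}$. Let $P$ be a path with $\ell\geq 2$ vertices and let $\Lambda$ be a subset of its vertices containing both endpoints of $P$. Then for any configuration $\tau:\Lambda\to[q]$, \[\mu_P(P\text{ is bichromatic}\mid\sigma_\Lambda=\tau)\leq (4q/B)^{|\Lambda|}\chi^{\ell-2|\Lambda|},\] where $\mu_P$ is the Potts distribution on $P$ with parameter $B$.
   Context: Potts distribution: $\mu_G(\sigma)=B^{m(\sigma)}/Z_G$ for $\sigma:V\to[q]$, with $m(\sigma)$ the number of monochromatic edges. A path is bichromatic under $\sigma$ if there exist colours $c_1,c_2\in[q]$ such that every vertex of the path has colour in $\{c_1,c_2\}$. $\sigma_\Lambda$ is the restriction of $\sigma$ to $\Lambda$.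
   Formalization: The parameter $B$ takes only rational values in $(0,1)$. -}

module Defs where

open import Data.Nat as ℕ using (ℕ; zero; suc)
open import Data.Integer as ℤ using (ℤ; +_; -[1+_])
open import Data.Rational using (ℚ; 0ℚ; 1ℚ; _+_; _*_; _÷_; 1/_; ≢-nonZero)
open import Data.Rational.Properties using (_≟_)
open import Data.Fin using (Fin; zero; suc)
open import Data.Fin.Properties using (any?; all?) renaming (_≟_ to _≟ᶠ_)
open import Data.Fin.Subset using (Subset; _∈_)
open import Data.Fin.Subset.Properties using (_∈?_)
open import Data.Vec using (_∷_; [])
open import Data.Product using (∃; ∃-syntax; _×_)
open import Data.Sum using (_⊎_)
open import Relation.Nullary using (Dec; yes; no; does)
open import Relation.Nullary.Decidable using (_⊎-dec_; _→-dec_)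
open import Relation.Binary.PropositionalEquality using (_≡_)
open import Data.Bool using (if_then_else_)

_^_ : ℚ → ℕ → ℚ
x ^ zero  = 1ℚ
x ^ suc n = x * (x ^ n)

-- total inverse (1/0 := 0; only ever applied to nonzero values below)
inv : ℚ → ℚ
inv x with x ≟ 0ℚ
... | yes _  = 0ℚ
... | no x≢0 = 1/_ x {{≢-nonZero x≢0}}

_^ᶻ_ : ℚ → ℤ → ℚ
x ^ᶻ (+ n)    = x ^ n
x ^ᶻ -[1+ n ] = inv (x ^ suc n)

ℕ→ℚ : ℕ → ℚ
ℕ→ℚ n = ℤ.+ n Data.Rational./ 1

sumFin : (q : ℕ) → (Fin q → ℚ) → ℚ
sumFin zero    f = 0ℚ
sumFin (suc q) f = f zero + sumFin q (λ i → f (suc i))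

sumConf : (q n : ℕ) → ((Fin n → Fin q) → ℚ) → ℚ
sumConf q zero    f = f (λ ())
sumConf q (suc n) f = sumFin q (λ c → sumConf q n (λ σ → f (λ { zero → c ; (suc i) → σ i })))

-- The path P_ℓ: vertex set Fin ℓ, edges {i, i+1}.
-- Configurations σ : Fin ℓ → Fin q  (i.e. σ : V → [q]).

mono : {q : ℕ} (ℓ : ℕ) → (Fin ℓ → Fin q) → ℕ
mono zero          σ = 0
mono (suc zero)    σ = 0
mono (suc (suc ℓ)) σ =
  (if does (σ zero ≟ᶠ σ (suc zero)) then 1 else 0) ℕ.+ mono (suc ℓ) (λ i → σ (suc i))

Bichromatic : {q ℓ : ℕ} → (Fin ℓ → Fin q) → Set
Bichromatic {q} {ℓ} σ = ∃[ c₁ ] ∃[ c₂ ] (∀ (i : Fin ℓ) → (σ i ≡ c₁ ⊎ σ i ≡ c₂))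

bichromatic? : {q ℓ : ℕ} → (σ : Fin ℓ → Fin q) → Dec (Bichromatic σ)
bichromatic? σ = any? (λ c₁ → any? (λ c₂ → all? (λ i → (σ i ≟ᶠ c₁) ⊎-dec (σ i ≟ᶠ c₂))))

-- σ_Λ = τ : σ agrees with τ on Λ  (τ is a configuration on Λ; its values
-- outside Λ are irrelevant)
Agrees : {q ℓ : ℕ} → Subset ℓ → (Fin ℓ → Fin q) → (Fin ℓ → Fin q) → Set
Agrees {ℓ = ℓ} Λ τ σ = ∀ (i : Fin ℓ) → i ∈ Λ → σ i ≡ τ i

agrees? : {q ℓ : ℕ} → (Λ : Subset ℓ) → (τ σ : Fin ℓ → Fin q) → Dec (Agrees Λ τ σ)
agrees? Λ τ σ = all? (λ i → (i ∈? Λ) →-dec (σ i ≟ᶠ τ i))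

𝟙 : {P : Set} → Dec P → ℚ
𝟙 d = if does d then 1ℚ else 0ℚ

weight : (q ℓ : ℕ) → ℚ → (Fin ℓ → Fin q) → ℚ
weight q ℓ B σ = B ^ mono ℓ σ

-- μ_P(P bichromatic | σ_Λ = τ)
--   = Σ_σ B^{m(σ)} 1[σ_Λ=τ] 1[σ bichromatic] / Σ_σ B^{m(σ)} 1[σ_Λ=τ]
condBichromatic : (q ℓ : ℕ) → ℚ → Subset ℓ → (Fin ℓ → Fin q) → ℚ
condBichromatic q ℓ B Λ τ =
  sumConf q ℓ (λ σ → weight q ℓ B σ * (𝟙 (agrees? Λ τ σ) * 𝟙 (bichromatic? σ)))
  * inv (sumConf q ℓ (λ σ → weight q ℓ B σ * 𝟙 (agrees? Λ τ σ)))

χ : ℕ → ℚ → ℚ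
χ q B = (1ℚ + B) * inv (B + ℕ→ℚ (q ℕ.∸ 1))

{-# OPTIONS --safe #-}

-- Write Λ = {0} ∪ (1 + Λ′) and let A be the number of free vertices. Summing the Potts
-- weight along the path vertex by vertex, a vertex next to one of colour a contributes
-- Σ_c B^[a = c] = B + q − 1 if it is free and B^[a = τᵢ] ≥ B if it is pinned, so the
-- normalising sum is at least B^|Λ′| (B + q − 1)^A. A bichromatic σ with σ₀ = τ₀ only
-- uses colours {τ₀, c} for some c; with colours restricted to such a pair, a free vertex
-- contributes at most B^[a = τ₀] + B^[a = c] ≤ 1 + B and a pinned one at most 1, so the
-- numerator is at most q (1 + B)^A. The resulting ratio q B^−|Λ′| χ^A is below the claimed
-- bound because χ ≤ 1 and 4q/B ≥ max(q, 1/B).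

module Submission where

open import Defs
open import Data.Nat using (ℕ; suc; _≥_)
open import Data.Integer using (_-_)
open import Data.Rational using (ℚ; 0ℚ; 1ℚ; _<_; _≤_; _*_)
open import Data.Fin using (Fin; zero; fromℕ)
open import Data.Fin.Subset using (Subset; _∈_; ∣_∣)
open import Data.Integer using (+_)

open import Data.Bool using (Bool; true; false; T; _∧_; if_then_else_)
open import Data.Empty using (⊥-elim)
open import Data.Fin using (suc)
open import Data.Fin.Properties using (all?) renaming (_≟_ to _≟ᶠ_)
open import Data.Fin.Subset using (inside; ∁)
open import Data.Fin.Subset.Properties using (_∈?_; ∣∁p∣≡n∸∣p∣; ∣p∣≤n)
open import Data.Integer as ℤ using (-[1+_]; _⊖_)
import Data.Integer.Properties as ℤP
open import Data.Nat as ℕ using (zero; _∸_)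
import Data.Nat.Properties as ℕP
open import Data.Product using (∃; _×_; _,_)
open import Data.Rational using (_+_; toℚᵘ; positive; nonNegative; ≢-nonZero)
open import Data.Rational.Properties as ℚP
  using (≤-refl; ≤-reflexive; ≤-trans; <⇒≤; <-≤-trans; +-mono-≤; +-monoʳ-≤;
         *-comm; *-assoc; *-identityˡ; *-identityʳ; *-zeroˡ; *-zeroʳ; +-comm; +-identityʳ;
         *-distribˡ-+; *-distribʳ-+)
open import Data.Rational.Solver using (module +-*-Solver)
open +-*-Solver using (solve; _:+_; _:*_; _:=_; con)
import Data.Rational.Unnormalised as ℚᵘ
import Data.Rational.Unnormalised.Properties as ℚᵘP
open import Data.Sum using (_⊎_; inj₁; inj₂; map₁; map₂; swap)
open import Data.Unit using (tt)
open import Data.Vec using ([]; _∷_; here)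
open import Data.Vec.Functional using () renaming (_∷_ to _◂_)
open import Function using (_∘_)
open import Relation.Nullary using (Dec; yes; no; does; ¬_)
open import Relation.Nullary.Decidable using (_×-dec_; _⊎-dec_; _→-dec_; T?)
open import Relation.Unary.Properties using (U?)
open import Relation.Binary.PropositionalEquality using (_≡_; refl; sym; trans; cong; cong₂; module ≡-Reasoning)

0≤1 : 0ℚ ≤ 1ℚ
0≤1 = ℚP.nonNegative⁻¹ 1ℚ

*-monoˡ-≤ : ∀ {r p s} → 0ℚ ≤ r → p ≤ s → r * p ≤ r * s
*-monoˡ-≤ {r} 0≤r = ℚP.*-monoˡ-≤-nonNeg r {{nonNegative 0≤r}}

*-monoʳ-≤ : ∀ {r p s} → 0ℚ ≤ r → p ≤ s → p * r ≤ s * r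
*-monoʳ-≤ {r} 0≤r = ℚP.*-monoʳ-≤-nonNeg r {{nonNegative 0≤r}}

*-mono-≤ : ∀ {p q s t} → 0ℚ ≤ q → 0ℚ ≤ s → p ≤ q → s ≤ t → p * s ≤ q * t
*-mono-≤ 0≤q 0≤s p≤q s≤t = ≤-trans (*-monoʳ-≤ 0≤s p≤q) (*-monoˡ-≤ 0≤q s≤t)

*-nonNeg : ∀ {x y} → 0ℚ ≤ x → 0ℚ ≤ y → 0ℚ ≤ x * y
*-nonNeg {x} {y} 0≤x 0≤y = ℚP.nonNegative⁻¹ (x * y)
  {{ℚP.nonNeg*nonNeg⇒nonNeg x {{nonNegative 0≤x}} y {{nonNegative 0≤y}}}}

*-pos : ∀ {x y} → 0ℚ < x → 0ℚ < y → 0ℚ < x * y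
*-pos {x} {y} 0<x 0<y = ℚP.positive⁻¹ (x * y)
  {{ℚP.pos*pos⇒pos x {{positive 0<x}} y {{positive 0<y}}}}

*-zero-≤ : ∀ {x y z} → x ≡ 0ℚ → x * y ≤ x * z
*-zero-≤ {y = y} {z} refl = ≤-reflexive (trans (*-zeroˡ y) (sym (*-zeroˡ z)))

^-+ : ∀ x m n → x ^ (m ℕ.+ n) ≡ x ^ m * x ^ n
^-+ x zero    n = sym (*-identityˡ (x ^ n))
^-+ x (suc m) n = trans (cong (x *_) (^-+ x m n)) (sym (*-assoc x (x ^ m) (x ^ n)))

^-* : ∀ x y n → (x * y) ^ n ≡ x ^ n * y ^ n
^-* x y zero    = refl
^-* x y (suc n) = trans (cong ((x * y) *_) (^-* x y n))
  (solve 4 (λ x y a b → (x :* y) :* (a :* b) := (x :* a) :* (y :* b)) refl x y (x ^ n) (y ^ n))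

1^n≡1 : ∀ n → 1ℚ ^ n ≡ 1ℚ
1^n≡1 zero    = refl
1^n≡1 (suc n) = trans (cong (1ℚ *_) (1^n≡1 n)) (*-identityˡ 1ℚ)

^-nonNeg : ∀ {x} n → 0ℚ ≤ x → 0ℚ ≤ x ^ n
^-nonNeg zero    _   = 0≤1
^-nonNeg (suc n) 0≤x = *-nonNeg 0≤x (^-nonNeg n 0≤x)

^-pos : ∀ {x} n → 0ℚ < x → 0ℚ < x ^ n
^-pos zero    _   = ℚP.positive⁻¹ 1ℚ
^-pos (suc n) 0<x = *-pos 0<x (^-pos n 0<x)

^-monoˡ-≤ : ∀ {x y} n → 0ℚ ≤ x → x ≤ y → x ^ n ≤ y ^ n
^-monoˡ-≤ zero    _   _   = ≤-refl
^-monoˡ-≤ (suc n) 0≤x x≤y =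
  *-mono-≤ (≤-trans 0≤x x≤y) (^-nonNeg n 0≤x) x≤y (^-monoˡ-≤ n 0≤x x≤y)

^-≤-1 : ∀ {x} n → 0ℚ ≤ x → x ≤ 1ℚ → x ^ n ≤ 1ℚ
^-≤-1 n 0≤x x≤1 = ≤-trans (^-monoˡ-≤ n 0≤x x≤1) (≤-reflexive (1^n≡1 n))

^-antitoneʳ : ∀ {x m n} → 0ℚ ≤ x → x ≤ 1ℚ → m ℕ.≤ n → x ^ n ≤ x ^ m
^-antitoneʳ {n = n} 0≤x x≤1 ℕ.z≤n     = ^-≤-1 n 0≤x x≤1
^-antitoneʳ         0≤x x≤1 (ℕ.s≤s m≤n) = *-monoˡ-≤ 0≤x (^-antitoneʳ 0≤x x≤1 m≤n)

inv-*ˡ : ∀ {x} → 0ℚ < x → inv x * x ≡ 1ℚ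
inv-*ˡ {x} 0<x with x ℚP.≟ 0ℚ
... | yes refl = ⊥-elim (ℚP.<-irrefl refl 0<x)
... | no x≢0   = ℚP.*-inverseˡ x {{≢-nonZero x≢0}}

inv-*ʳ : ∀ {x} → 0ℚ < x → x * inv x ≡ 1ℚ
inv-*ʳ {x} 0<x = trans (*-comm x (inv x)) (inv-*ˡ 0<x)

inv-pos : ∀ {x} → 0ℚ < x → 0ℚ < inv x
inv-pos {x} 0<x with x ℚP.≟ 0ℚ
... | yes refl = ⊥-elim (ℚP.<-irrefl refl 0<x)
... | no x≢0   = ℚP.positive⁻¹ _ {{ℚP.1/pos⇒pos x {{positive 0<x}}}}

inv-≥-1 : ∀ {x} → 0ℚ < x → x ≤ 1ℚ → 1ℚ ≤ inv x
inv-≥-1 {x} 0<x x≤1 = begin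
  1ℚ          ≡⟨ sym (inv-*ˡ 0<x) ⟩
  inv x * x   ≤⟨ *-monoˡ-≤ (<⇒≤ (inv-pos 0<x)) x≤1 ⟩
  inv x * 1ℚ  ≡⟨ *-identityʳ (inv x) ⟩
  inv x       ∎
  where open ℚP.≤-Reasoning

*-inv-≤ : ∀ {n d y} → 0ℚ < d → n ≤ y * d → n * inv d ≤ y
*-inv-≤ {n} {d} {y} 0<d n≤yd = begin
  n * inv d        ≤⟨ *-monoʳ-≤ (<⇒≤ (inv-pos 0<d)) n≤yd ⟩
  y * d * inv d    ≡⟨ *-assoc y d (inv d) ⟩
  y * (d * inv d)  ≡⟨ cong (y *_) (inv-*ʳ 0<d) ⟩
  y * 1ℚ           ≡⟨ *-identityʳ y ⟩
  y                ∎
  where open ℚP.≤-Reasoning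

ℕ→ℚ-suc : ∀ n → ℕ→ℚ (suc n) ≡ 1ℚ + ℕ→ℚ n
ℕ→ℚ-suc n = ℚP.toℚᵘ-injective (begin
  toℚᵘ (ℕ→ℚ (suc n))               ≈⟨ ℚP.toℚᵘ-fromℚᵘ (ℚᵘ.mkℚᵘ (+ suc n) 0) ⟩
  ℚᵘ.mkℚᵘ (+ suc n) 0              ≈⟨ ℚᵘ.*≡* (cross-multiplied n) ⟩
  ℚᵘ.1ℚᵘ ℚᵘ.+ ℚᵘ.mkℚᵘ (+ n) 0      ≈⟨ ℚᵘP.+-congʳ ℚᵘ.1ℚᵘ (ℚᵘP.≃-sym (ℚP.toℚᵘ-fromℚᵘ (ℚᵘ.mkℚᵘ (+ n) 0))) ⟩
  ℚᵘ.1ℚᵘ ℚᵘ.+ toℚᵘ (ℕ→ℚ n)         ≈⟨ ℚᵘP.≃-sym (ℚP.toℚᵘ-homo-+ 1ℚ (ℕ→ℚ n)) ⟩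
  toℚᵘ (1ℚ + ℕ→ℚ n)                ∎)
  where
  open ℚᵘP.≃-Reasoning
  cross-multiplied : ∀ n → + suc n ℤ.* ℚᵘ.↧ (ℚᵘ.1ℚᵘ ℚᵘ.+ ℚᵘ.mkℚᵘ (+ n) 0)
                         ≡ ℚᵘ.↥ (ℚᵘ.1ℚᵘ ℚᵘ.+ ℚᵘ.mkℚᵘ (+ n) 0) ℤ.* + 1
  cross-multiplied zero    = refl
  cross-multiplied (suc n) = cong (λ m → + suc (suc m)) (sym (ℕP.*-identityʳ (n ℕ.* 1)))

ℕ→ℚ-nonNeg : ∀ n → 0ℚ ≤ ℕ→ℚ n
ℕ→ℚ-nonNeg n = ℚP.nonNegative⁻¹ (ℕ→ℚ n) {{ℚP.normalize-nonNeg n 1}}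

ℕ→ℚ-mono : ∀ {m n} → m ℕ.≤ n → ℕ→ℚ m ≤ ℕ→ℚ n
ℕ→ℚ-mono {n = n} ℕ.z≤n = ℕ→ℚ-nonNeg n
ℕ→ℚ-mono {suc m} {suc n} (ℕ.s≤s m≤n) = begin
  ℕ→ℚ (suc m)   ≡⟨ ℕ→ℚ-suc m ⟩
  1ℚ + ℕ→ℚ m    ≤⟨ +-monoʳ-≤ 1ℚ (ℕ→ℚ-mono m≤n) ⟩
  1ℚ + ℕ→ℚ n    ≡⟨ sym (ℕ→ℚ-suc n) ⟩
  ℕ→ℚ (suc n)   ∎
  where open ℚP.≤-Reasoning

^-≤-^ᶻ : ∀ {x m z} → 0ℚ < x → x ≤ 1ℚ → z ℤ.≤ + m → x ^ m ≤ x ^ᶻ z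
^-≤-^ᶻ 0<x x≤1 (ℤ.+≤+ n≤m) = ^-antitoneʳ (<⇒≤ 0<x) x≤1 n≤m
^-≤-^ᶻ {x} {m} { -[1+ n ]} 0<x x≤1 _ =
  ≤-trans (^-≤-1 m (<⇒≤ 0<x) x≤1) (inv-≥-1 (^-pos (suc n) 0<x) (^-≤-1 (suc n) (<⇒≤ 0<x) x≤1))

1+n-2[1+b]≤a : ∀ {n} b a → b ℕ.+ a ≡ n → (+ suc n) - (+ (2 ℕ.* suc b)) ℤ.≤ + a
1+n-2[1+b]≤a b a refl = begin
  + suc (b ℕ.+ a) - + (2 ℕ.* suc b)        ≡⟨ ℤP.m-n≡m⊖n (suc b ℕ.+ a) (2 ℕ.* suc b) ⟩
  (suc b ℕ.+ a) ⊖ (suc b ℕ.+ (suc b ℕ.+ 0)) ≡⟨ cong (λ c → (suc b ℕ.+ a) ⊖ (suc b ℕ.+ c)) (ℕP.+-identityʳ (suc b)) ⟩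
  (suc b ℕ.+ a) ⊖ (suc b ℕ.+ suc b)         ≡⟨ ℤP.+-cancelˡ-⊖ (suc b) a (suc b) ⟩
  a ⊖ suc b                                 ≤⟨ ℤP.m⊖n≤m a (suc b) ⟩
  + a                                       ∎
  where open ℤP.≤-Reasoning

sumFin-cong : ∀ {n} {f g : Fin n → ℚ} → (∀ i → f i ≡ g i) → sumFin n f ≡ sumFin n g
sumFin-cong {zero}  _   = refl
sumFin-cong {suc n} f≗g = cong₂ _+_ (f≗g zero) (sumFin-cong (f≗g ∘ suc))

sumFin-mono : ∀ {n} {f g : Fin n → ℚ} → (∀ i → f i ≤ g i) → sumFin n f ≤ sumFin n g
sumFin-mono {zero}  _   = ≤-refl
sumFin-mono {suc n} f≤g = +-mono-≤ (f≤g zero) (sumFin-mono (f≤g ∘ suc))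

sumFin-nonNeg : ∀ {n} {f : Fin n → ℚ} → (∀ i → 0ℚ ≤ f i) → 0ℚ ≤ sumFin n f
sumFin-nonNeg {zero}  _     = ≤-refl
sumFin-nonNeg {suc n} 0≤f = +-mono-≤ (0≤f zero) (sumFin-nonNeg (0≤f ∘ suc))

sumFin-term : ∀ {n} {f : Fin n → ℚ} → (∀ i → 0ℚ ≤ f i) → ∀ i → f i ≤ sumFin n f
sumFin-term {suc n} {f} 0≤f zero =
  ≤-trans (≤-reflexive (sym (+-identityʳ (f zero)))) (+-monoʳ-≤ (f zero) (sumFin-nonNeg (0≤f ∘ suc)))
sumFin-term {suc n} {f} 0≤f (suc i) =
  ≤-trans (sumFin-term (0≤f ∘ suc) i)
    (≤-trans (≤-reflexive (sym (ℚP.+-identityˡ _))) (ℚP.+-monoˡ-≤ _ (0≤f zero)))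

sumFin-*ˡ : ∀ {n} k (f : Fin n → ℚ) → sumFin n (λ i → k * f i) ≡ k * sumFin n f
sumFin-*ˡ {zero}  k f = sym (*-zeroʳ k)
sumFin-*ˡ {suc n} k f =
  trans (cong (_+_ (k * f zero)) (sumFin-*ˡ k (f ∘ suc))) (sym (*-distribˡ-+ k (f zero) _))

sumFin-*ʳ : ∀ {n} k (f : Fin n → ℚ) → sumFin n (λ i → f i * k) ≡ sumFin n f * k
sumFin-*ʳ k f = trans (sumFin-cong (λ i → *-comm (f i) k)) (trans (sumFin-*ˡ k f) (*-comm k _))

sumFin-+ : ∀ {n} (f g : Fin n → ℚ) → sumFin n (λ i → f i + g i) ≡ sumFin n f + sumFin n g
sumFin-+ {zero}  f g = refl
sumFin-+ {suc n} f g = trans (cong (_+_ (f zero + g zero)) (sumFin-+ (f ∘ suc) (g ∘ suc)))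
  (solve 4 (λ a b c d → (a :+ b) :+ (c :+ d) := (a :+ c) :+ (b :+ d)) refl (f zero) (g zero) _ _)

sumFin-zero : ∀ n → sumFin n (λ _ → 0ℚ) ≡ 0ℚ
sumFin-zero zero    = refl
sumFin-zero (suc n) = cong (_+_ 0ℚ) (sumFin-zero n)

sumFin-comm : ∀ m n (F : Fin m → Fin n → ℚ) →
  sumFin m (λ i → sumFin n (F i)) ≡ sumFin n (λ j → sumFin m (λ i → F i j))
sumFin-comm zero    n F = sym (sumFin-zero n)
sumFin-comm (suc m) n F = trans (cong (_+_ (sumFin n (F zero))) (sumFin-comm m n (F ∘ suc)))
  (sym (sumFin-+ (F zero) (λ j → sumFin m (λ i → F (suc i) j))))

sumFin-const : ∀ n x → sumFin n (λ _ → x) ≡ ℕ→ℚ n * x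
sumFin-const zero    x = sym (*-zeroˡ x)
sumFin-const (suc n) x = begin
  x + sumFin n (λ _ → x)   ≡⟨ cong₂ _+_ (sym (*-identityˡ x)) (sumFin-const n x) ⟩
  1ℚ * x + ℕ→ℚ n * x       ≡⟨ sym (*-distribʳ-+ x 1ℚ (ℕ→ℚ n)) ⟩
  (1ℚ + ℕ→ℚ n) * x         ≡⟨ cong (_* x) (sym (ℕ→ℚ-suc n)) ⟩
  ℕ→ℚ (suc n) * x          ∎
  where open ≡-Reasoning

sumFin-δ : ∀ {n} (t : Fin n) (g : Fin n → ℚ) → sumFin n (λ c → 𝟙 (c ≟ᶠ t) * g c) ≡ g t
sumFin-δ {suc n} zero g = begin
  1ℚ * g zero + sumFin n (λ c → 0ℚ * g (suc c))  ≡⟨ cong₂ _+_ (*-identityˡ (g zero)) (sumFin-cong (λ c → *-zeroˡ (g (suc c)))) ⟩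
  g zero + sumFin n (λ _ → 0ℚ)                   ≡⟨ cong (_+_ (g zero)) (sumFin-zero n) ⟩
  g zero + 0ℚ                                    ≡⟨ +-identityʳ (g zero) ⟩
  g zero                                         ∎
  where open ≡-Reasoning
sumFin-δ {suc n} (suc t) g =
  trans (cong (_+ sumFin n (λ c → 𝟙 (c ≟ᶠ t) * g (suc c))) (*-zeroˡ (g zero)))
        (trans (ℚP.+-identityˡ _) (sumFin-δ t (g ∘ suc)))

module _ {q : ℕ} where

  sumConf-cong : ∀ n {f g : (Fin n → Fin q) → ℚ} → (∀ σ → f σ ≡ g σ) → sumConf q n f ≡ sumConf q n g
  sumConf-cong zero    f≗g = f≗g _
  sumConf-cong (suc n) f≗g = sumFin-cong {q} (λ c → sumConf-cong n (λ σ → f≗g _))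

  sumConf-mono : ∀ n {f g : (Fin n → Fin q) → ℚ} → (∀ σ → f σ ≤ g σ) → sumConf q n f ≤ sumConf q n g
  sumConf-mono zero    f≤g = f≤g _
  sumConf-mono (suc n) f≤g = sumFin-mono {q} (λ c → sumConf-mono n (λ σ → f≤g _))

  sumConf-*ˡ : ∀ n k (f : (Fin n → Fin q) → ℚ) → sumConf q n (λ σ → k * f σ) ≡ k * sumConf q n f
  sumConf-*ˡ zero    k f = refl
  sumConf-*ˡ (suc n) k f = trans (sumFin-cong {q} (λ c → sumConf-*ˡ n k _)) (sumFin-*ˡ {q} k _)

  sumConf-sumFin : ∀ n r (F : Fin r → (Fin n → Fin q) → ℚ) →
    sumConf q n (λ σ → sumFin r (λ j → F j σ)) ≡ sumFin r (λ j → sumConf q n (F j))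
  sumConf-sumFin zero    r F = refl
  sumConf-sumFin (suc n) r F = trans (sumFin-cong {q} (λ c → sumConf-sumFin n r _)) (sumFin-comm q r _)

private
  variable
    X Y : Set

𝟙-nonNeg : (X? : Dec X) → 0ℚ ≤ 𝟙 X?
𝟙-nonNeg (yes _) = 0≤1
𝟙-nonNeg (no _)  = ≤-refl

𝟙-≤-1 : (X? : Dec X) → 𝟙 X? ≤ 1ℚ
𝟙-≤-1 (yes _) = ≤-refl
𝟙-≤-1 (no _)  = 0≤1

𝟙-yes : (X? : Dec X) → X → 𝟙 X? ≡ 1ℚ
𝟙-yes (yes _) _ = refl
𝟙-yes (no ¬p) p = ⊥-elim (¬p p)

𝟙-no : (X? : Dec X) → ¬ X → 𝟙 X? ≡ 0ℚ
𝟙-no (yes p) ¬p = ⊥-elim (¬p p)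
𝟙-no (no _)  _  = refl

𝟙-cong : (X? : Dec X) (Y? : Dec Y) → does X? ≡ does Y? → 𝟙 X? ≡ 𝟙 Y?
𝟙-cong X? Y? eq = cong (λ b → if b then 1ℚ else 0ℚ) eq

𝟙-× : (X? : Dec X) (Y? : Dec Y) → 𝟙 (X? ×-dec Y?) ≡ 𝟙 X? * 𝟙 Y?
𝟙-× (yes _) Y? = sym (*-identityˡ (𝟙 Y?))
𝟙-× (no _)  Y? = sym (*-zeroˡ (𝟙 Y?))

𝟙-⊎-≤ : (X? : Dec X) (Y? : Dec Y) → 𝟙 (X? ⊎-dec Y?) ≤ 𝟙 X? + 𝟙 Y?
𝟙-⊎-≤ (yes _) Y? = ≤-trans (≤-reflexive (sym (+-identityʳ 1ℚ))) (+-monoʳ-≤ 1ℚ (𝟙-nonNeg Y?))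
𝟙-⊎-≤ (no _)  Y? = ≤-reflexive (sym (ℚP.+-identityˡ (𝟙 Y?)))

𝟙-≤-sumFin : ∀ {n} {P : Set} {Q : Fin n → Set} (P? : Dec P) (Q? : ∀ i → Dec (Q i)) →
  (P → ∃ Q) → 𝟙 P? ≤ sumFin n (λ i → 𝟙 (Q? i))
𝟙-≤-sumFin (no _)  Q? _       = sumFin-nonNeg (λ i → 𝟙-nonNeg (Q? i))
𝟙-≤-sumFin (yes p) Q? witness with witness p
... | i , qi = ≤-trans (≤-reflexive (sym (𝟙-yes (Q? i) qi))) (sumFin-term (λ j → 𝟙-nonNeg (Q? j)) i)

does-all?-cong : ∀ {n} {P Q : Fin n → Set} (P? : ∀ i → Dec (P i)) (Q? : ∀ i → Dec (Q i)) →
  (∀ i → does (P? i) ≡ does (Q? i)) → does (all? P?) ≡ does (all? Q?)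
does-all?-cong {zero}  P? Q? eq = refl
does-all?-cong {suc n} P? Q? eq = cong₂ _∧_ (eq zero) (does-all?-cong (P? ∘ suc) (Q? ∘ suc) (eq ∘ suc))

agrees?-tail : ∀ {q m} s (Λ : Subset m) (τ σ : Fin (suc m) → Fin q) →
  does (all? (λ i → (suc i ∈? s ∷ Λ) →-dec (σ (suc i) ≟ᶠ τ (suc i))))
    ≡ does (agrees? Λ (τ ∘ suc) (σ ∘ suc))
agrees?-tail s Λ τ σ = does-all?-cong _ (λ i → (i ∈? Λ) →-dec (σ (suc i) ≟ᶠ τ (suc i))) (λ _ → refl)

agrees?-∷ : ∀ {q m} s (Λ : Subset m) (τ σ : Fin (suc m) → Fin q) →
  does (agrees? (s ∷ Λ) τ σ)
    ≡ does ((T? s →-dec σ zero ≟ᶠ τ zero) ×-dec agrees? Λ (τ ∘ suc) (σ ∘ suc))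
agrees?-∷ true  Λ τ σ = cong (does (σ zero ≟ᶠ τ zero) ∧_) (agrees?-tail true Λ τ σ)
agrees?-∷ false Λ τ σ = agrees?-tail false Λ τ σ

bichromatic-with : ∀ {q ℓ} {σ : Fin ℓ → Fin q} {a : Fin q} i → σ i ≡ a → Bichromatic σ →
  ∃ λ c → ∀ j → σ j ≡ a ⊎ σ j ≡ c
bichromatic-with {σ = σ} i σi≡a (c₁ , c₂ , σ⊆) with σ⊆ i
... | inj₁ σi≡c₁ = c₂ , λ j → map₁ (λ σj≡c₁ → trans σj≡c₁ (trans (sym σi≡c₁) σi≡a)) (σ⊆ j)
... | inj₂ σi≡c₂ = c₁ , λ j → swap (map₂ (λ σj≡c₂ → trans σj≡c₂ (trans (sym σi≡c₂) σi≡a)) (σ⊆ j))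

^-powers-∷ : ∀ {m} (u : Bool → ℚ) s (Λ : Subset m) →
  u s * (u true ^ ∣ Λ ∣ * u false ^ ∣ ∁ Λ ∣) ≡ u true ^ ∣ s ∷ Λ ∣ * u false ^ ∣ ∁ (s ∷ Λ) ∣
^-powers-∷ u true  Λ = sym (*-assoc (u true) _ _)
^-powers-∷ u false Λ = solve 3 (λ y x z → y :* (x :* z) := x :* (y :* z)) refl
  (u false) (u true ^ ∣ Λ ∣) (u false ^ ∣ ∁ Λ ∣)

monoEdge : ∀ {q} → Fin q → Fin q → ℕ
monoEdge a c = if does (a ≟ᶠ c) then 1 else 0

sumFin-^-monoEdge : ∀ {q} B (a : Fin q) → sumFin q (λ c → B ^ monoEdge a c) ≡ B + ℕ→ℚ (q ∸ 1)
sumFin-^-monoEdge {suc r} B zero = cong₂ _+_ (*-identityʳ B) (trans (sumFin-const r 1ℚ) (*-identityʳ (ℕ→ℚ r)))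
sumFin-^-monoEdge {suc (suc r)} B (suc a) = begin
  1ℚ + sumFin (suc r) (λ c → B ^ monoEdge a c)   ≡⟨ cong (_+_ 1ℚ) (sumFin-^-monoEdge B a) ⟩
  1ℚ + (B + ℕ→ℚ r)                               ≡⟨ solve 2 (λ b n → con 1ℚ :+ (b :+ n) := b :+ (con 1ℚ :+ n)) refl B (ℕ→ℚ r) ⟩
  B + (1ℚ + ℕ→ℚ r)                               ≡⟨ cong (_+_ B) (sym (ℕ→ℚ-suc r)) ⟩
  B + ℕ→ℚ (suc r)                                ∎
  where open ≡-Reasoning

module PottsPath {q : ℕ} (B : ℚ) where

  monoFrom : Fin q → ∀ {m} → (Fin m → Fin q) → ℕ
  monoFrom a {zero}  σ = 0
  monoFrom a {suc m} σ = monoEdge a (σ zero) ℕ.+ monoFrom (σ zero) (σ ∘ suc)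

  mono≡monoFrom : ∀ m (σ : Fin (suc m) → Fin q) → mono (suc m) σ ≡ monoFrom (σ zero) (σ ∘ suc)
  mono≡monoFrom zero    σ = refl
  mono≡monoFrom (suc m) σ = cong (monoEdge (σ zero) (σ (suc zero)) ℕ.+_) (mono≡monoFrom m (σ ∘ suc))

  ^-monoEdge-≡ : (a : Fin q) → B ^ monoEdge a a ≡ B
  ^-monoEdge-≡ a with a ≟ᶠ a
  ... | yes _  = *-identityʳ B
  ... | no a≢a = ⊥-elim (a≢a refl)

  module _ {P : Fin q → Set} (P? : ∀ c → Dec (P c)) where

    constraints : ∀ {m} → Subset m → (τ σ : Fin m → Fin q) → ℚ
    constraints Λ τ σ = 𝟙 (agrees? Λ τ σ) * 𝟙 (all? (P? ∘ σ))

    vertexConstraint : Bool → (t c : Fin q) → ℚ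
    vertexConstraint s t c = 𝟙 (T? s →-dec c ≟ᶠ t) * 𝟙 (P? c)

    transfer : Bool → (t a c : Fin q) → ℚ
    transfer s t a c = B ^ monoEdge a c * vertexConstraint s t c

    -- Z a Λ τ: the partition function of a path hanging off a vertex of colour a,
    -- pinned to τ on Λ and using only colours in P.
    Z : Fin q → ∀ {m} → Subset m → (Fin m → Fin q) → ℚ
    Z a {m} Λ τ = sumConf q m (λ σ → B ^ monoFrom a σ * constraints Λ τ σ)

    pathSum : ∀ {m} → Subset (suc m) → (Fin (suc m) → Fin q) → ℚ
    pathSum {m} Λ τ = sumConf q (suc m) (λ σ → weight q (suc m) B σ * constraints Λ τ σ)

    constraints-∷ : ∀ {m} s (Λ : Subset m) (τ σ : Fin (suc m) → Fin q) →
      constraints (s ∷ Λ) τ σ ≡ vertexConstraint s (τ zero) (σ zero) * constraints Λ (τ ∘ suc) (σ ∘ suc)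
    constraints-∷ s Λ τ σ = begin
      𝟙 (agrees? (s ∷ Λ) τ σ) * 𝟙 (all? (P? ∘ σ))
        ≡⟨ cong₂ _*_ (trans (𝟙-cong (agrees? (s ∷ Λ) τ σ) (pin ×-dec agrees? Λ τ′ σ′) (agrees?-∷ s Λ τ σ))
                            (𝟙-× pin (agrees? Λ τ′ σ′)))
                     (𝟙-× (P? (σ zero)) (all? (P? ∘ σ′))) ⟩
      (𝟙 pin * 𝟙 (agrees? Λ τ′ σ′)) * (𝟙 (P? (σ zero)) * 𝟙 (all? (P? ∘ σ′)))
        ≡⟨ solve 4 (λ a b c d → (a :* b) :* (c :* d) := (a :* c) :* (b :* d)) refl
             (𝟙 pin) (𝟙 (agrees? Λ τ′ σ′)) (𝟙 (P? (σ zero))) (𝟙 (all? (P? ∘ σ′))) ⟩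
      vertexConstraint s (τ zero) (σ zero) * constraints Λ τ′ σ′ ∎
      where
      open ≡-Reasoning
      τ′ σ′ : Fin _ → Fin q
      τ′ = τ ∘ suc
      σ′ = σ ∘ suc
      pin : Dec (T s → σ zero ≡ τ zero)
      pin = T? s →-dec σ zero ≟ᶠ τ zero

    pathSum-∷ : ∀ {m} s (Λ : Subset m) τ →
      pathSum (s ∷ Λ) τ ≡ sumFin q (λ c → vertexConstraint s (τ zero) c * Z c Λ (τ ∘ suc))
    pathSum-∷ {m} s Λ τ =
      sumFin-cong {q} (λ c → trans (sumConf-cong m (λ σ → summand-∷ _))
                                   (sumConf-*ˡ m (vertexConstraint s (τ zero) c)
                                                 (λ σ → B ^ monoFrom c σ * constraints Λ (τ ∘ suc) σ)))
      where
      summand-∷ : (σ : Fin (suc m) → Fin q) →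
        weight q (suc m) B σ * constraints (s ∷ Λ) τ σ
          ≡ vertexConstraint s (τ zero) (σ zero) * (B ^ monoFrom (σ zero) (σ ∘ suc) * constraints Λ (τ ∘ suc) (σ ∘ suc))
      summand-∷ σ =
        trans (cong₂ _*_ (cong (B ^_) (mono≡monoFrom m σ)) (constraints-∷ s Λ τ σ))
              (solve 3 (λ x y z → x :* (y :* z) := y :* (x :* z)) refl
                (B ^ monoFrom (σ zero) (σ ∘ suc)) (vertexConstraint s (τ zero) (σ zero)) (constraints Λ (τ ∘ suc) (σ ∘ suc)))

    pathSum-pinned : ∀ {m} (Λ : Subset m) τ → pathSum (inside ∷ Λ) τ ≡ 𝟙 (P? (τ zero)) * Z (τ zero) Λ (τ ∘ suc)
    pathSum-pinned Λ τ = begin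
      pathSum (inside ∷ Λ) τ
        ≡⟨ pathSum-∷ inside Λ τ ⟩
      sumFin q (λ c → 𝟙 (c ≟ᶠ τ zero) * 𝟙 (P? c) * Z c Λ (τ ∘ suc))
        ≡⟨ sumFin-cong (λ c → *-assoc (𝟙 (c ≟ᶠ τ zero)) (𝟙 (P? c)) (Z c Λ (τ ∘ suc))) ⟩
      sumFin q (λ c → 𝟙 (c ≟ᶠ τ zero) * (𝟙 (P? c) * Z c Λ (τ ∘ suc)))
        ≡⟨ sumFin-δ (τ zero) (λ c → 𝟙 (P? c) * Z c Λ (τ ∘ suc)) ⟩
      𝟙 (P? (τ zero)) * Z (τ zero) Λ (τ ∘ suc) ∎
      where open ≡-Reasoning

    Z-∷ : ∀ {m} a s (Λ : Subset m) τ →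
      Z a (s ∷ Λ) τ ≡ sumFin q (λ c → transfer s (τ zero) a c * Z c Λ (τ ∘ suc))
    Z-∷ {m} a s Λ τ =
      sumFin-cong {q} (λ c → trans (sumConf-cong m (λ σ → summand-∷ (c ◂ σ)))
                                   (sumConf-*ˡ m (transfer s (τ zero) a c)
                                                 (λ σ → B ^ monoFrom c σ * constraints Λ (τ ∘ suc) σ)))
      where
      summand-∷ : (σ : Fin (suc m) → Fin q) →
        B ^ monoFrom a σ * constraints (s ∷ Λ) τ σ
          ≡ transfer s (τ zero) a (σ zero) * (B ^ monoFrom (σ zero) (σ ∘ suc) * constraints Λ (τ ∘ suc) (σ ∘ suc))
      summand-∷ σ =
        trans (cong₂ _*_ (^-+ B (monoEdge a (σ zero)) _) (constraints-∷ s Λ τ σ))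
              (solve 4 (λ x y z w → (x :* y) :* (z :* w) := (x :* z) :* (y :* w)) refl
                (B ^ monoEdge a (σ zero)) (B ^ monoFrom (σ zero) (σ ∘ suc))
                (vertexConstraint s (τ zero) (σ zero)) (constraints Λ (τ ∘ suc) (σ ∘ suc)))

    transfer-nonNeg : 0ℚ ≤ B → ∀ s t a c → 0ℚ ≤ transfer s t a c
    transfer-nonNeg 0≤B s t a c =
      *-nonNeg (^-nonNeg (monoEdge a c) 0≤B) (*-nonNeg (𝟙-nonNeg (T? s →-dec c ≟ᶠ t)) (𝟙-nonNeg (P? c)))

    transfer-¬P : ∀ {c} s t a → ¬ P c → transfer s t a c ≡ 0ℚ
    transfer-¬P {c} s t a ¬Pc = begin
      B ^ monoEdge a c * (𝟙 (T? s →-dec c ≟ᶠ t) * 𝟙 (P? c)) ≡⟨ cong (λ x → B ^ monoEdge a c * (𝟙 (T? s →-dec c ≟ᶠ t) * x)) (𝟙-no (P? c) ¬Pc) ⟩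
      B ^ monoEdge a c * (𝟙 (T? s →-dec c ≟ᶠ t) * 0ℚ)       ≡⟨ cong (B ^ monoEdge a c *_) (*-zeroʳ (𝟙 (T? s →-dec c ≟ᶠ t))) ⟩
      B ^ monoEdge a c * 0ℚ                                 ≡⟨ *-zeroʳ (B ^ monoEdge a c) ⟩
      0ℚ                                                    ∎
      where open ≡-Reasoning

    -- The invariant P a propagates along the path since transfer vanishes at colours outside P.
    Z-≤ : 0ℚ ≤ B → (u : Bool → ℚ) → (∀ s → 0ℚ ≤ u s) →
      (∀ s t a → P a → sumFin q (transfer s t a) ≤ u s) →
      ∀ {m} (Λ : Subset m) τ {a} → P a → Z a Λ τ ≤ u true ^ ∣ Λ ∣ * u false ^ ∣ ∁ Λ ∣
    Z-≤ 0≤B u 0≤u sum≤u []      τ     _  = ≤-refl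
    Z-≤ 0≤B u 0≤u sum≤u (s ∷ Λ) τ {a} Pa = begin
      Z a (s ∷ Λ) τ                                 ≡⟨ Z-∷ a s Λ τ ⟩
      sumFin q (λ c → transfer s t a c * Z c Λ τ′)  ≤⟨ sumFin-mono (λ c → step c (P? c)) ⟩
      sumFin q (λ c → transfer s t a c * R)         ≡⟨ sumFin-*ʳ R (transfer s t a) ⟩
      sumFin q (transfer s t a) * R                 ≤⟨ *-monoʳ-≤ 0≤R (sum≤u s t a Pa) ⟩
      u s * R                                       ≡⟨ ^-powers-∷ u s Λ ⟩
      u true ^ ∣ s ∷ Λ ∣ * u false ^ ∣ ∁ (s ∷ Λ) ∣  ∎
      where
      open ℚP.≤-Reasoning
      t : Fin q
      t = τ zero
      τ′ : Fin _ → Fin q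
      τ′ = τ ∘ suc
      R : ℚ
      R = u true ^ ∣ Λ ∣ * u false ^ ∣ ∁ Λ ∣
      0≤R : 0ℚ ≤ R
      0≤R = *-nonNeg (^-nonNeg ∣ Λ ∣ (0≤u true)) (^-nonNeg ∣ ∁ Λ ∣ (0≤u false))
      step : ∀ c → Dec (P c) → transfer s t a c * Z c Λ τ′ ≤ transfer s t a c * R
      step c (yes Pc) = *-monoˡ-≤ (transfer-nonNeg 0≤B s t a c) (Z-≤ 0≤B u 0≤u sum≤u Λ τ′ Pc)
      step c (no ¬Pc) = *-zero-≤ (transfer-¬P s t a ¬Pc)

    Z-≥ : 0ℚ ≤ B → (l : Bool → ℚ) → (∀ s → 0ℚ ≤ l s) →
      (∀ s t a → l s ≤ sumFin q (transfer s t a)) →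
      ∀ {m} (Λ : Subset m) τ a → l true ^ ∣ Λ ∣ * l false ^ ∣ ∁ Λ ∣ ≤ Z a Λ τ
    Z-≥ 0≤B l 0≤l l≤sum []      τ a = ≤-refl
    Z-≥ 0≤B l 0≤l l≤sum (s ∷ Λ) τ a = begin
      l true ^ ∣ s ∷ Λ ∣ * l false ^ ∣ ∁ (s ∷ Λ) ∣  ≡⟨ sym (^-powers-∷ l s Λ) ⟩
      l s * L                                       ≤⟨ *-monoʳ-≤ 0≤L (l≤sum s t a) ⟩
      sumFin q (transfer s t a) * L                 ≡⟨ sym (sumFin-*ʳ L (transfer s t a)) ⟩
      sumFin q (λ c → transfer s t a c * L)         ≤⟨ sumFin-mono (λ c → *-monoˡ-≤ (transfer-nonNeg 0≤B s t a c)
                                                                                (Z-≥ 0≤B l 0≤l l≤sum Λ τ′ c)) ⟩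
      sumFin q (λ c → transfer s t a c * Z c Λ τ′)  ≡⟨ sym (Z-∷ a s Λ τ) ⟩
      Z a (s ∷ Λ) τ                                 ∎
      where
      open ℚP.≤-Reasoning
      t : Fin q
      t = τ zero
      τ′ : Fin _ → Fin q
      τ′ = τ ∘ suc
      L : ℚ
      L = l true ^ ∣ Λ ∣ * l false ^ ∣ ∁ Λ ∣
      0≤L : 0ℚ ≤ L
      0≤L = *-nonNeg (^-nonNeg ∣ Λ ∣ (0≤l true)) (^-nonNeg ∣ ∁ Λ ∣ (0≤l false))

  pair? : (c₁ c₂ c : Fin q) → Dec (c ≡ c₁ ⊎ c ≡ c₂)
  pair? c₁ c₂ c = (c ≟ᶠ c₁) ⊎-dec (c ≟ᶠ c₂)

  module _ (0≤B : 0ℚ ≤ B) (B≤1 : B ≤ 1ℚ) where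

    ^-monoEdge-≤-1 : (a c : Fin q) → B ^ monoEdge a c ≤ 1ℚ
    ^-monoEdge-≤-1 a c = ^-≤-1 (monoEdge a c) 0≤B B≤1

    ^-monoEdge-≥ : (a c : Fin q) → B ≤ B ^ monoEdge a c
    ^-monoEdge-≥ a c with does (a ≟ᶠ c)
    ... | true  = ≤-reflexive (sym (*-identityʳ B))
    ... | false = B≤1

    monoEdge-pair-≤ : {a c₁ c₂ : Fin q} → a ≡ c₁ ⊎ a ≡ c₂ → B ^ monoEdge a c₁ + B ^ monoEdge a c₂ ≤ 1ℚ + B
    monoEdge-pair-≤ {a} {c₂ = c₂} (inj₁ refl) = begin
      B ^ monoEdge a a + B ^ monoEdge a c₂   ≡⟨ cong (_+ B ^ monoEdge a c₂) (^-monoEdge-≡ a) ⟩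
      B + B ^ monoEdge a c₂                  ≤⟨ +-monoʳ-≤ B (^-monoEdge-≤-1 a c₂) ⟩
      B + 1ℚ                                 ≡⟨ +-comm B 1ℚ ⟩
      1ℚ + B                                 ∎
      where open ℚP.≤-Reasoning
    monoEdge-pair-≤ {a} {c₁} (inj₂ refl) = begin
      B ^ monoEdge a c₁ + B ^ monoEdge a a   ≡⟨ cong (_+_ (B ^ monoEdge a c₁)) (^-monoEdge-≡ a) ⟩
      B ^ monoEdge a c₁ + B                  ≤⟨ ℚP.+-monoˡ-≤ B (^-monoEdge-≤-1 a c₁) ⟩
      1ℚ + B                                 ∎
      where open ℚP.≤-Reasoning


    sumFin-transfer-pinned-≤ : ∀ {P : Fin q → Set} (P? : ∀ c → Dec (P c)) t a →
      sumFin q (transfer P? true t a) ≤ 1ℚ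
    sumFin-transfer-pinned-≤ P? t a = begin
      sumFin q (transfer P? true t a)     ≤⟨ sumFin-mono term-≤ ⟩
      sumFin q (λ c → 𝟙 (c ≟ᶠ t) * 1ℚ)  ≡⟨ sumFin-δ t (λ _ → 1ℚ) ⟩
      1ℚ                                 ∎
      where
      open ℚP.≤-Reasoning
      term-≤ : ∀ c → transfer P? true t a c ≤ 𝟙 (c ≟ᶠ t) * 1ℚ
      term-≤ c = ≤-trans
        (*-mono-≤ 0≤1 (*-nonNeg (𝟙-nonNeg (c ≟ᶠ t)) (𝟙-nonNeg (P? c)))
                  (^-monoEdge-≤-1 a c) (*-monoˡ-≤ (𝟙-nonNeg (c ≟ᶠ t)) (𝟙-≤-1 (P? c))))
        (≤-reflexive (*-identityˡ _))

    sumFin-transfer-pair-≤ : ∀ {c₁ c₂ a} t → a ≡ c₁ ⊎ a ≡ c₂ →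
      sumFin q (transfer (pair? c₁ c₂) false t a) ≤ 1ℚ + B
    sumFin-transfer-pair-≤ {c₁} {c₂} {a} t a∈ = begin
      sumFin q (transfer (pair? c₁ c₂) false t a)              ≤⟨ sumFin-mono term-≤ ⟩
      sumFin q (λ c → 𝟙 (c ≟ᶠ c₁) * w c + 𝟙 (c ≟ᶠ c₂) * w c)  ≡⟨ sumFin-+ (λ c → 𝟙 (c ≟ᶠ c₁) * w c) (λ c → 𝟙 (c ≟ᶠ c₂) * w c) ⟩
      sumFin q (λ c → 𝟙 (c ≟ᶠ c₁) * w c)
        + sumFin q (λ c → 𝟙 (c ≟ᶠ c₂) * w c)                  ≡⟨ cong₂ _+_ (sumFin-δ c₁ w) (sumFin-δ c₂ w) ⟩
      w c₁ + w c₂                                              ≤⟨ monoEdge-pair-≤ a∈ ⟩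
      1ℚ + B                                                   ∎
      where
      open ℚP.≤-Reasoning
      w : Fin q → ℚ
      w c = B ^ monoEdge a c
      term-≤ : ∀ c → transfer (pair? c₁ c₂) false t a c ≤ 𝟙 (c ≟ᶠ c₁) * w c + 𝟙 (c ≟ᶠ c₂) * w c
      term-≤ c = begin
        w c * (1ℚ * 𝟙 (pair? c₁ c₂ c))              ≡⟨ cong (w c *_) (*-identityˡ _) ⟩
        w c * 𝟙 (pair? c₁ c₂ c)                     ≤⟨ *-monoˡ-≤ (^-nonNeg (monoEdge a c) 0≤B) (𝟙-⊎-≤ (c ≟ᶠ c₁) (c ≟ᶠ c₂)) ⟩
        w c * (𝟙 (c ≟ᶠ c₁) + 𝟙 (c ≟ᶠ c₂))          ≡⟨ trans (*-comm (w c) _) (*-distribʳ-+ (w c) (𝟙 (c ≟ᶠ c₁)) (𝟙 (c ≟ᶠ c₂))) ⟩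
        𝟙 (c ≟ᶠ c₁) * w c + 𝟙 (c ≟ᶠ c₂) * w c       ∎

    sumFin-transfer-pinned-≥ : ∀ t a → B ≤ sumFin q (transfer U? true t a)
    sumFin-transfer-pinned-≥ t a = begin
      B                                          ≤⟨ ^-monoEdge-≥ a t ⟩
      B ^ monoEdge a t                           ≡⟨ sym (sumFin-δ t (λ c → B ^ monoEdge a c)) ⟩
      sumFin q (λ c → 𝟙 (c ≟ᶠ t) * B ^ monoEdge a c)  ≡⟨ sumFin-cong (λ c → *-comm (𝟙 (c ≟ᶠ t)) (B ^ monoEdge a c)) ⟩
      sumFin q (λ c → B ^ monoEdge a c * 𝟙 (c ≟ᶠ t))  ≡⟨ sumFin-cong (λ c → cong (B ^ monoEdge a c *_) (sym (*-identityʳ (𝟙 (c ≟ᶠ t))))) ⟩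
      sumFin q (transfer U? true t a)            ∎
      where open ℚP.≤-Reasoning

    sumFin-transfer-free-≡ : ∀ t a → sumFin q (transfer U? false t a) ≡ B + ℕ→ℚ (q ∸ 1)
    sumFin-transfer-free-≡ t a =
      trans (sumFin-cong (λ c → *-identityʳ (B ^ monoEdge a c))) (sumFin-^-monoEdge B a)

    partition-≥ : ∀ {m} (Λ : Subset m) τ →
      B ^ ∣ Λ ∣ * (B + ℕ→ℚ (q ∸ 1)) ^ ∣ ∁ Λ ∣
        ≤ sumConf q (suc m) (λ σ → weight q (suc m) B σ * 𝟙 (agrees? (inside ∷ Λ) τ σ))
    partition-≥ {m} Λ τ = begin
      B ^ ∣ Λ ∣ * (B + ℕ→ℚ (q ∸ 1)) ^ ∣ ∁ Λ ∣  ≤⟨ Z-≥ U? 0≤B l 0≤l l≤sum Λ (τ ∘ suc) (τ zero) ⟩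
      Z U? (τ zero) Λ (τ ∘ suc)                ≡⟨ sym (*-identityˡ _) ⟩
      1ℚ * Z U? (τ zero) Λ (τ ∘ suc)           ≡⟨ sym (pathSum-pinned U? Λ τ) ⟩
      pathSum U? (inside ∷ Λ) τ                ≡⟨ sumConf-cong (suc m) (λ σ → cong (weight q (suc m) B σ *_)
                                                    (trans (cong (𝟙 (agrees? (inside ∷ Λ) τ σ) *_) (𝟙-yes (all? (U? ∘ σ)) (λ _ → tt)))
                                                           (*-identityʳ (𝟙 (agrees? (inside ∷ Λ) τ σ))))) ⟩
      sumConf q (suc m) (λ σ → weight q (suc m) B σ * 𝟙 (agrees? (inside ∷ Λ) τ σ)) ∎
      where
      open ℚP.≤-Reasoning
      l : Bool → ℚ
      l s = if s then B else B + ℕ→ℚ (q ∸ 1)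
      0≤l : ∀ s → 0ℚ ≤ l s
      0≤l true  = 0≤B
      0≤l false = +-mono-≤ 0≤B (ℕ→ℚ-nonNeg (q ∸ 1))
      l≤sum : ∀ s t a → l s ≤ sumFin q (transfer U? s t a)
      l≤sum true  t a = sumFin-transfer-pinned-≥ t a
      l≤sum false t a = ≤-reflexive (sym (sumFin-transfer-free-≡ t a))

    bichromatic-≤ : ∀ {m} (Λ : Subset m) τ →
      sumConf q (suc m) (λ σ → weight q (suc m) B σ * (𝟙 (agrees? (inside ∷ Λ) τ σ) * 𝟙 (bichromatic? σ)))
        ≤ ℕ→ℚ q * (1ℚ + B) ^ ∣ ∁ Λ ∣
    bichromatic-≤ {m} Λ τ = begin
      sumConf q (suc m) (λ σ → weight q (suc m) B σ * (𝟙 (agrees? (inside ∷ Λ) τ σ) * 𝟙 (bichromatic? σ)))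
        ≤⟨ sumConf-mono (suc m) union-bound ⟩
      sumConf q (suc m) (λ σ → sumFin q (λ c → weight q (suc m) B σ * constraints (pair? (τ zero) c) (inside ∷ Λ) τ σ))
        ≡⟨ sumConf-sumFin (suc m) q (λ c σ → weight q (suc m) B σ * constraints (pair? (τ zero) c) (inside ∷ Λ) τ σ) ⟩
      sumFin q (λ c → pathSum (pair? (τ zero) c) (inside ∷ Λ) τ)
        ≤⟨ sumFin-mono (λ c → pair-≤ c) ⟩
      sumFin q (λ _ → (1ℚ + B) ^ ∣ ∁ Λ ∣)
        ≡⟨ sumFin-const q _ ⟩
      ℕ→ℚ q * (1ℚ + B) ^ ∣ ∁ Λ ∣ ∎
      where
      open ℚP.≤-Reasoning
      union-bound : ∀ σ → weight q (suc m) B σ * (𝟙 (agrees? (inside ∷ Λ) τ σ) * 𝟙 (bichromatic? σ))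
                            ≤ sumFin q (λ c → weight q (suc m) B σ * constraints (pair? (τ zero) c) (inside ∷ Λ) τ σ)
      union-bound σ = begin
        W * (𝟙 (agrees? (inside ∷ Λ) τ σ) * 𝟙 (bichromatic? σ))
          ≡⟨ cong (W *_) (sym (𝟙-× (agrees? (inside ∷ Λ) τ σ) (bichromatic? σ))) ⟩
        W * 𝟙 (agrees? (inside ∷ Λ) τ σ ×-dec bichromatic? σ)
          ≤⟨ *-monoˡ-≤ (^-nonNeg (mono (suc m) σ) 0≤B) (𝟙-≤-sumFin (agrees? (inside ∷ Λ) τ σ ×-dec bichromatic? σ) pinned-pair? witness) ⟩
        W * sumFin q (λ c → 𝟙 (pinned-pair? c))
          ≡⟨ sym (sumFin-*ˡ W (λ c → 𝟙 (pinned-pair? c))) ⟩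
        sumFin q (λ c → W * 𝟙 (pinned-pair? c))
          ≡⟨ sumFin-cong (λ c → cong (W *_) (𝟙-× (agrees? (inside ∷ Λ) τ σ) (all? (pair? (τ zero) c ∘ σ)))) ⟩
        sumFin q (λ c → W * constraints (pair? (τ zero) c) (inside ∷ Λ) τ σ) ∎
        where
        W : ℚ
        W = weight q (suc m) B σ
        pinned-pair? : ∀ c → Dec (Agrees (inside ∷ Λ) τ σ × (∀ i → σ i ≡ τ zero ⊎ σ i ≡ c))
        pinned-pair? c = agrees? (inside ∷ Λ) τ σ ×-dec all? (pair? (τ zero) c ∘ σ)
        witness : Agrees (inside ∷ Λ) τ σ × Bichromatic σ →
                  ∃ λ c → Agrees (inside ∷ Λ) τ σ × (∀ i → σ i ≡ τ zero ⊎ σ i ≡ c)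
        witness (agrees , bichromatic) with bichromatic-with zero (agrees zero here) bichromatic
        ... | c , σ⊆ = c , agrees , σ⊆
      pair-≤ : ∀ c → pathSum (pair? (τ zero) c) (inside ∷ Λ) τ ≤ (1ℚ + B) ^ ∣ ∁ Λ ∣
      pair-≤ c = begin
        pathSum (pair? (τ zero) c) (inside ∷ Λ) τ
          ≡⟨ pathSum-pinned (pair? (τ zero) c) Λ τ ⟩
        𝟙 (pair? (τ zero) c (τ zero)) * Z (pair? (τ zero) c) (τ zero) Λ (τ ∘ suc)
          ≡⟨ trans (cong (_* Z (pair? (τ zero) c) (τ zero) Λ (τ ∘ suc)) (𝟙-yes (pair? (τ zero) c (τ zero)) (inj₁ refl)))
                   (*-identityˡ (Z (pair? (τ zero) c) (τ zero) Λ (τ ∘ suc))) ⟩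
        Z (pair? (τ zero) c) (τ zero) Λ (τ ∘ suc)
          ≤⟨ Z-≤ (pair? (τ zero) c) 0≤B u 0≤u sum≤u Λ (τ ∘ suc) (inj₁ refl) ⟩
        1ℚ ^ ∣ Λ ∣ * (1ℚ + B) ^ ∣ ∁ Λ ∣
          ≡⟨ trans (cong (_* (1ℚ + B) ^ ∣ ∁ Λ ∣) (1^n≡1 ∣ Λ ∣)) (*-identityˡ ((1ℚ + B) ^ ∣ ∁ Λ ∣)) ⟩
        (1ℚ + B) ^ ∣ ∁ Λ ∣ ∎
        where
        u : Bool → ℚ
        u s = if s then 1ℚ else 1ℚ + B
        0≤u : ∀ s → 0ℚ ≤ u s
        0≤u true  = 0≤1
        0≤u false = +-mono-≤ 0≤1 0≤B
        sum≤u : ∀ s t a → a ≡ τ zero ⊎ a ≡ c → sumFin q (transfer (pair? (τ zero) c) s t a) ≤ u s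
        sum≤u true  t a _  = sumFin-transfer-pinned-≤ (pair? (τ zero) c) t a
        sum≤u false t a a∈ = sumFin-transfer-pair-≤ t a∈

∣p∣+∣∁p∣≡n : ∀ {n} (p : Subset n) → ∣ p ∣ ℕ.+ ∣ ∁ p ∣ ≡ n
∣p∣+∣∁p∣≡n p = trans (cong (∣ p ∣ ℕ.+_) (∣∁p∣≡n∸∣p∣ p)) (ℕP.m+[n∸m]≡n (∣p∣≤n p))

module Ratio {q : ℕ} {B : ℚ} (2≤q : 2 ℕ.≤ q) (0<B : 0ℚ < B) (B≤1 : B ≤ 1ℚ) where

  Q W : ℚ
  Q = B + ℕ→ℚ (q ∸ 1)
  W = ℕ→ℚ (4 ℕ.* q) * inv B

  0≤B : 0ℚ ≤ B
  0≤B = <⇒≤ 0<B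

  0<1+B : 0ℚ < 1ℚ + B
  0<1+B = ℚP.positive⁻¹ (1ℚ + B) {{ℚP.pos+nonNeg⇒pos 1ℚ B {{nonNegative 0≤B}}}}

  1+B≤Q : 1ℚ + B ≤ Q
  1+B≤Q = ≤-trans (≤-reflexive (+-comm 1ℚ B)) (+-monoʳ-≤ B (ℕ→ℚ-mono (ℕP.∸-monoˡ-≤ 1 2≤q)))

  0<Q : 0ℚ < Q
  0<Q = <-≤-trans 0<1+B 1+B≤Q

  χ*Q≡1+B : χ q B * Q ≡ 1ℚ + B
  χ*Q≡1+B = trans (*-assoc (1ℚ + B) (inv Q) Q) (trans (cong ((1ℚ + B) *_) (inv-*ˡ 0<Q)) (*-identityʳ (1ℚ + B)))

  0<χ : 0ℚ < χ q B
  0<χ = *-pos 0<1+B (inv-pos 0<Q)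

  χ≤1 : χ q B ≤ 1ℚ
  χ≤1 = ≤-trans (*-monoʳ-≤ (<⇒≤ (inv-pos 0<Q)) 1+B≤Q) (≤-reflexive (inv-*ʳ 0<Q))

  0≤invB : 0ℚ ≤ inv B
  0≤invB = <⇒≤ (inv-pos 0<B)

  q≤W : ℕ→ℚ q ≤ W
  q≤W = ≤-trans (≤-reflexive (sym (*-identityʳ (ℕ→ℚ q))))
    (*-mono-≤ (ℕ→ℚ-nonNeg (4 ℕ.* q)) 0≤1 (ℕ→ℚ-mono (ℕP.m≤n*m q 4)) (inv-≥-1 0<B B≤1))

  invB≤W : inv B ≤ W
  invB≤W = ≤-trans (≤-reflexive (sym (*-identityˡ (inv B))))
    (*-monoʳ-≤ 0≤invB (ℕ→ℚ-mono (ℕP.≤-trans (ℕP.≤-trans (ℕ.s≤s ℕ.z≤n) 2≤q) (ℕP.m≤n*m q 4))))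

  q*invB^b≤W^1+b : ∀ b → ℕ→ℚ q * inv B ^ b ≤ W ^ suc b
  q*invB^b≤W^1+b b = *-mono-≤ (≤-trans (ℕ→ℚ-nonNeg q) q≤W) (^-nonNeg b 0≤invB) q≤W (^-monoˡ-≤ b 0≤invB invB≤W)

  numeratorBound : ℕ → ℚ
  numeratorBound a = ℕ→ℚ q * (1ℚ + B) ^ a

  denominatorBound : ℕ → ℕ → ℚ
  denominatorBound b a = B ^ b * Q ^ a

  ratioBound : ℕ → ℕ → ℚ
  ratioBound b a = ℕ→ℚ q * inv B ^ b * χ q B ^ a

  numeratorBound≡ratioBound*denominatorBound : ∀ b a →
    numeratorBound a ≡ ratioBound b a * denominatorBound b a
  numeratorBound≡ratioBound*denominatorBound b a = sym (begin
    (ℕ→ℚ q * inv B ^ b * χ q B ^ a) * (B ^ b * Q ^ a)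
      ≡⟨ solve 5 (λ n x y z w → (n :* x :* y) :* (z :* w) := n :* (x :* z) :* (y :* w)) refl
           (ℕ→ℚ q) (inv B ^ b) (χ q B ^ a) (B ^ b) (Q ^ a) ⟩
    ℕ→ℚ q * (inv B ^ b * B ^ b) * (χ q B ^ a * Q ^ a)
      ≡⟨ cong₂ (λ x y → ℕ→ℚ q * x * y) (sym (^-* (inv B) B b)) (sym (^-* (χ q B) Q a)) ⟩
    ℕ→ℚ q * (inv B * B) ^ b * (χ q B * Q) ^ a
      ≡⟨ cong₂ (λ x y → ℕ→ℚ q * x ^ b * y ^ a) (inv-*ˡ 0<B) χ*Q≡1+B ⟩
    ℕ→ℚ q * 1ℚ ^ b * (1ℚ + B) ^ a
      ≡⟨ cong (λ x → ℕ→ℚ q * x * (1ℚ + B) ^ a) (1^n≡1 b) ⟩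
    ℕ→ℚ q * 1ℚ * (1ℚ + B) ^ a
      ≡⟨ cong (_* (1ℚ + B) ^ a) (*-identityʳ (ℕ→ℚ q)) ⟩
    ℕ→ℚ q * (1ℚ + B) ^ a ∎)
    where open ≡-Reasoning

  ratioBound-≤ : ∀ b a {z} → z ℤ.≤ + a → ratioBound b a ≤ W ^ suc b * χ q B ^ᶻ z
  ratioBound-≤ b a z≤a = *-mono-≤ (^-nonNeg (suc b) (≤-trans (ℕ→ℚ-nonNeg q) q≤W)) (^-nonNeg a (<⇒≤ 0<χ))
    (q*invB^b≤W^1+b b) (^-≤-^ᶻ 0<χ χ≤1 z≤a)

  ratio-≤ : ∀ {N D b a z} → N ≤ numeratorBound a → denominatorBound b a ≤ D → z ℤ.≤ + a →
    N * inv D ≤ W ^ suc b * χ q B ^ᶻ z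
  ratio-≤ {N} {D} {b} {a} {z} N≤ D≥ z≤a = *-inv-≤ 0<D (begin
    N                                        ≤⟨ N≤ ⟩
    numeratorBound a                         ≡⟨ numeratorBound≡ratioBound*denominatorBound b a ⟩
    ratioBound b a * denominatorBound b a    ≤⟨ *-monoˡ-≤ 0≤ratioBound D≥ ⟩
    ratioBound b a * D                       ≤⟨ *-monoʳ-≤ (<⇒≤ 0<D) (ratioBound-≤ b a z≤a) ⟩
    W ^ suc b * χ q B ^ᶻ z * D               ∎)
    where
    open ℚP.≤-Reasoning
    0<D : 0ℚ < D
    0<D = <-≤-trans (*-pos (^-pos b 0<B) (^-pos a 0<Q)) D≥
    0≤ratioBound : 0ℚ ≤ ratioBound b a
    0≤ratioBound = *-nonNeg (*-nonNeg (ℕ→ℚ-nonNeg q) (^-nonNeg b 0≤invB)) (^-nonNeg a (<⇒≤ 0<χ))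

corollary8p3 : (q : ℕ) → q ≥ 3 → (B : ℚ) → 0ℚ < B → B < 1ℚ →
    (k : ℕ) → suc k ≥ 2 → (Λ : Subset (suc k)) → zero ∈ Λ → fromℕ k ∈ Λ →
    (τ : Fin (suc k) → Fin q) →
    condBichromatic q (suc k) B Λ τ
      ≤ ((ℕ→ℚ (4 Data.Nat.* q) * inv B) ^ ∣ Λ ∣)
        * (χ q B ^ᶻ ((+ suc k) - (+ (2 Data.Nat.* ∣ Λ ∣))))
corollary8p3 q q≥3 B 0<B B<1 k _ (inside ∷ Λ) here _ τ =
  ratio-≤ {b = ∣ Λ ∣} (bichromatic-≤ 0≤B B≤1 Λ τ) (partition-≥ 0≤B B≤1 Λ τ)
    (1+n-2[1+b]≤a ∣ Λ ∣ ∣ ∁ Λ ∣ (∣p∣+∣∁p∣≡n Λ))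
  where
  B≤1 : B ≤ 1ℚ
  B≤1 = <⇒≤ B<1
  open PottsPath B
  open Ratio (ℕP.≤-trans (ℕP.n≤1+n 2) q≥3) 0<B B≤1
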